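{- Let $P$ be a pattern. Then $ssat(P,n)=O(1)$ if and only if all of the following hold: (1) the first row of $P$ contains a $1$ entry that is the only $1$ entry in its column, and the last row of $P$ contains a $1$ entry that is the only $1$ entry in its column; (2) the first column of $P$ contains a $1$ entry that is the only $1$ entry in its row, and the last column of $P$ contains a $1$ entry that is the only $1$ entry in its row; (3) $P$ contains a $1$ entry that is the only $1$ entry in both its row and its column. Otherwise $ssat(P,n)=\Theta(n)$.
   Context: All matrices are $0$-$1$ matrices; an $m\times n$ matrix has $m$ rows and $n$ columns. The weight of a matrix is its number of $1$ entries. A pattern is a $0$-$1$ matrix that is not all-zero. An occurrence of a $k\times l$ pattern $P$ in a matrix $M$ is a choice of rows $r_1<\dots<r_k$ and columns $c_1<\dots<c_l$ of $M$ such that $M(r_a,c_b)=1$ whenever $P(a,b)=1$. $ssat(P,m,n)$ is the minimum weight of an $m\times n$ matrix $M$ (not required to avoid $P$) such that changing any single $0$ entry of $M$ to $1$ yields a matrix $M'$ containing a new occurrence of $P$, i.e. an occurrence of $P$ in $M'$ that is not an occurrence of $P$ in $M$. $ssat(P,n)=ssat(P,n,n)$. -}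

module Defs where

open import Data.Nat using (ℕ; zero; suc; _+_; _*_; _∸_; _≤_)
open import Data.Bool using (Bool; true; false; if_then_else_; _∧_)
open import Data.Fin using (Fin; toℕ; _<_) renaming (zero to fzero; suc to fsuc)
open import Data.Fin.Properties using (_≟_)
open import Data.Product using (Σ; ∃; ∃-syntax; _×_; _,_)
open import Relation.Nullary using (¬_; does)
open import Relation.Binary.PropositionalEquality using (_≡_)
open import Function.Bundles using (_⇔_)

-- An m × n 0-1 matrix (true = 1, false = 0).
Mat : ℕ → ℕ → Set
Mat m n = Fin m → Fin n → Bool

sumFin : (n : ℕ) → (Fin n → ℕ) → ℕ
sumFin zero    f = 0
sumFin (suc n) f = f fzero + sumFin n (λ i → f (fsuc i))

b2n : Bool → ℕ
b2n true  = 1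
b2n false = 0

weight : ∀ {m n} → Mat m n → ℕ
weight {m} {n} M = sumFin m (λ i → sumFin n (λ j → b2n (M i j)))

IsPattern : ∀ {k l} → Mat k l → Set
IsPattern P = ∃[ a ] ∃[ b ] (P a b ≡ true)

StrictlyIncreasing : ∀ {k m} → (Fin k → Fin m) → Set
StrictlyIncreasing r = ∀ a a' → a < a' → r a < r a'

IsOccurrence : ∀ {k l m n} → Mat k l → Mat m n →
               (Fin k → Fin m) → (Fin l → Fin n) → Set
IsOccurrence P M r c =
  StrictlyIncreasing r × StrictlyIncreasing c ×
  (∀ a b → P a b ≡ true → M (r a) (c b) ≡ true)

setOne : ∀ {m n} → Mat m n → Fin m → Fin n → Mat m n
setOne M i j i' j' = if does (i' ≟ i) ∧ does (j' ≟ j) then true else M i' j'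

IsSemisaturating : ∀ {k l m n} → Mat k l → Mat m n → Set
IsSemisaturating {k} {l} {m} {n} P M =
  ∀ i j → M i j ≡ false →
    Σ (Fin k → Fin m) λ r → Σ (Fin l → Fin n) λ c →
      IsOccurrence P (setOne M i j) r c × ¬ IsOccurrence P M r c

-- ssat(P,n) ≤ C  (unfolding of the minimum: some semisaturating n×n matrix has weight ≤ C)
SsatLE : ∀ {k l} → Mat k l → ℕ → ℕ → Set
SsatLE P n C = Σ (Mat n n) λ M → IsSemisaturating P M × weight M ≤ C

SsatBounded : ∀ {k l} → Mat k l → Set
SsatBounded P = ∃[ C ] ∃[ N ] (∀ n → N ≤ n → SsatLE P n C)

-- ssat(P,n) = Θ(n): for some constants d, C and all large n,
-- n ≤ d * ssat(P,n)  (i.e. every semisaturating n×n matrix M has n ≤ d * weight M)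
-- and ssat(P,n) ≤ C * n.
SsatLinear : ∀ {k l} → Mat k l → Set
SsatLinear P = ∃[ d ] ∃[ C ] ∃[ N ] (∀ n → N ≤ n →
  ((M : Mat n n) → IsSemisaturating P M → n ≤ d * weight M) × SsatLE P n (C * n))

OnlyInColumn : ∀ {k l} → Mat k l → Fin k → Fin l → Set
OnlyInColumn P a b = P a b ≡ true × (∀ a' → P a' b ≡ true → a' ≡ a)

OnlyInRow : ∀ {k l} → Mat k l → Fin k → Fin l → Set
OnlyInRow P a b = P a b ≡ true × (∀ b' → P a b' ≡ true → b' ≡ b)

Cond1 : ∀ {k l} → Mat k l → Set
Cond1 {k} P =
  (∃[ a ] ∃[ b ] (toℕ a ≡ 0 × OnlyInColumn P a b)) ×
  (∃[ a ] ∃[ b ] (suc (toℕ a) ≡ k × OnlyInColumn P a b))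

Cond2 : ∀ {k l} → Mat k l → Set
Cond2 {k} {l} P =
  (∃[ a ] ∃[ b ] (toℕ b ≡ 0 × OnlyInRow P a b)) ×
  (∃[ a ] ∃[ b ] (suc (toℕ b) ≡ l × OnlyInRow P a b))

Cond3 : ∀ {k l} → Mat k l → Set
Cond3 P = ∃[ a ] ∃[ b ] (OnlyInRow P a b × OnlyInColumn P a b)

-- If a semisaturating n × n matrix M has fewer than n ones, it has an empty row and an
-- empty column. Setting a 0 of the empty column to 1 creates an occurrence through that
-- entry, and the 1 of P sent there is alone in its column, since any other 1 of that column
-- of P would land in the empty column of M. Doing this in the first and in the last row of M
-- gives (1); an empty row gives (2) in the same way, and the crossing of the two gives (3).
-- So (1)–(3) follow from ssat(P, n) < n.
--
-- Conversely, let w = k + l and call the first w and the last w indices the band. To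
-- saturate a 0 at (i, j), send some 1 of P to (i, j) and all other rows and columns of P into
-- the band. The frame matrix (every band row and band column full) is therefore semisaturating
-- for every P and has O(n) ones. The corner matrix (ones where both indices lie in the band)
-- has O(1) ones and is semisaturating under (1)–(3): for i in the band and j outside it, send
-- a 1 of the first or last row that is alone in its column, symmetrically when only j is in
-- the band, and a 1 alone in its row and column when neither is.

module Submission where

open import Defs
open import Data.Nat using (ℕ; zero; suc; _+_; _*_; _∸_; _≤_; _<_; z≤n; s≤s; z<s; s<s⁻¹; _≤?_; _<?_)
open import Data.Nat.Properties hiding (_≟_)
open import Algebra.Properties.Semiring.Sum +-*-semiring
  using (sum; sum-cong-≗; ∑-comm; ∑-distrib-+; *-distribʳ-sum)
open import Data.Bool using (Bool; true; false; _∧_; _∨_)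
open import Data.Fin using (Fin; toℕ; fromℕ; fromℕ<) renaming (zero to fzero; suc to fsuc)
open import Data.Product using (Σ; ∃; ∃-syntax; _×_; _,_; proj₁; proj₂)
open import Data.Sum using (_⊎_; inj₁; inj₂)
open import Data.Fin.Properties using (_≟_)
import Data.Fin.Properties as F
open import Relation.Binary using (tri<; tri≈; tri>)
open import Function using (_∘_)
open import Function.Bundles using (_⇔_; mk⇔)
open import Relation.Nullary using (¬_; Dec; does; yes; no; contradiction)
open import Relation.Nullary.Decidable using (_⊎-dec_; _×-dec_; dec-true)
import Data.Bool.Properties as B
open import Relation.Binary.PropositionalEquality
open ≤-Reasoning

-- Counting ones

sumFin≡sum : ∀ n (f : Fin n → ℕ) → sumFin n f ≡ sum f
sumFin≡sum zero    f = refl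
sumFin≡sum (suc n) f = cong (f fzero +_) (sumFin≡sum n (f ∘ fsuc))

sum-mono-≤ : ∀ {n} {f g : Fin n → ℕ} → (∀ i → f i ≤ g i) → sum f ≤ sum g
sum-mono-≤ {zero}  f≤g = z≤n
sum-mono-≤ {suc n} f≤g = +-mono-≤ (f≤g fzero) (sum-mono-≤ (f≤g ∘ fsuc))

sum-const : ∀ n c → sum {n} (λ _ → c) ≡ n * c
sum-const zero    c = refl
sum-const (suc n) c = cong (c +_) (sum-const n c)

sum<length⇒∃≡0 : ∀ {n} (f : Fin n → ℕ) → sum f < n → ∃[ i ] f i ≡ 0
sum<length⇒∃≡0 {suc n} f s<n with f fzero in eq
... | zero  = fzero , eq
... | suc _ with sum<length⇒∃≡0 (f ∘ fsuc) (<-≤-trans (m<n+m _ z<s) (s<s⁻¹ s<n))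
...   | i , fi≡0 = fsuc i , fi≡0

sum≡0⇒≡0 : ∀ {n} (f : Fin n → ℕ) → sum f ≡ 0 → ∀ i → f i ≡ 0
sum≡0⇒≡0 f s≡0 fzero    = m+n≡0⇒m≡0 (f fzero) s≡0
sum≡0⇒≡0 f s≡0 (fsuc i) = sum≡0⇒≡0 (f ∘ fsuc) (m+n≡0⇒n≡0 (f fzero) s≡0) i

count : ∀ {n} → (Fin n → Bool) → ℕ
count u = sum (b2n ∘ u)

count≤length : ∀ {n} (u : Fin n → Bool) → count u ≤ n
count≤length {zero}  u = z≤n
count≤length {suc n} u = +-mono-≤ (b2n≤1 (u fzero)) (count≤length (u ∘ fsuc))
  where
  b2n≤1 : ∀ x → b2n x ≤ 1
  b2n≤1 true  = ≤-refl
  b2n≤1 false = z≤n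

count-∨ : ∀ {n} (u v : Fin n → Bool) → count (λ x → u x ∨ v x) ≤ count u + count v
count-∨ u v = begin
  count (λ x → u x ∨ v x)            ≤⟨ sum-mono-≤ (λ x → b2n-∨ (u x) (v x)) ⟩
  sum (λ x → b2n (u x) + b2n (v x))  ≡⟨ ∑-distrib-+ (b2n ∘ u) (b2n ∘ v) ⟩
  count u + count v                  ∎
  where
  b2n-∨ : ∀ x y → b2n (x ∨ y) ≤ b2n x + b2n y
  b2n-∨ true  y = m≤m+n 1 (b2n y)
  b2n-∨ false y = ≤-refl

count-below : ∀ n w → count {n} (λ v → does (toℕ v <? w)) ≤ w
count-below zero    w       = z≤n
count-below (suc n) zero    = count-below n zero
count-below (suc n) (suc w) = s≤s (count-below n w)

count-above : ∀ n w → count {n} (λ v → does (n ≤? toℕ v + w)) ≤ w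
count-above zero    w = z≤n
count-above (suc n) w = begin
  b2n (does (suc n ≤? w)) + count {n} (λ v → does (suc n ≤? suc (toℕ v + w)))
    ≡⟨ cong (b2n (does (suc n ≤? w)) +_)
            (sum-cong-≗ {n} (λ v → cong b2n (does-≤?-suc n (toℕ v + w)))) ⟩
  b2n (does (suc n ≤? w)) + count {n} (λ v → does (n ≤? toℕ v + w))
    ≤⟨ first+rest≤w (suc n ≤? w) ⟩
  w ∎
  where
  -- Unlike `suc m <? suc o` in count-below, this does not hold definitionally.
  does-≤?-suc : ∀ m o → does (suc m ≤? suc o) ≡ does (m ≤? o)
  does-≤?-suc zero    o = refl
  does-≤?-suc (suc m) o = refl

  first+rest≤w : (d : Dec (suc n ≤ w)) → b2n (does d) + count {n} (λ v → does (n ≤? toℕ v + w)) ≤ w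
  first+rest≤w (yes n<w) = ≤-trans (s≤s (count≤length _)) n<w
  first+rest≤w (no _)    = count-above n w

weight≡sum-count : ∀ {m n} (M : Mat m n) → weight M ≡ sum (λ i → count (M i))
weight≡sum-count {m} {n} M =
  trans (sumFin≡sum m _) (sum-cong-≗ (λ i → sumFin≡sum n (b2n ∘ M i)))

weight≡sum-countᵀ : ∀ {m n} (M : Mat m n) → weight M ≡ sum (λ j → count (λ i → M i j))
weight≡sum-countᵀ M = trans (weight≡sum-count M) (∑-comm (λ i j → b2n (M i j)))

count-const : ∀ n x → count {n} (λ _ → x) ≡ b2n x * n
count-const n x = trans (sum-const n (b2n x)) (*-comm n (b2n x))

weight-grid : ∀ {m n} (u : Fin m → Bool) (v : Fin n → Bool) →
              weight (λ i j → u i ∧ v j) ≡ count u * count v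
weight-grid {m} {n} u v = begin-equality
  weight (λ i j → u i ∧ v j)           ≡⟨ weight≡sum-count (λ i j → u i ∧ v j) ⟩
  sum (λ i → count (λ j → u i ∧ v j))  ≡⟨ sum-cong-≗ (λ i → count-∧ (u i)) ⟩
  sum (λ i → b2n (u i) * count v)      ≡⟨ *-distribʳ-sum (count v) (b2n ∘ u) ⟨
  count u * count v                    ∎
  where
  count-∧ : ∀ x → count (λ j → x ∧ v j) ≡ b2n x * count v
  count-∧ true  = sym (+-identityʳ (count v))
  count-∧ false = count-const n false

weight-cross : ∀ {m n} (u : Fin m → Bool) (v : Fin n → Bool) →
               weight (λ i j → u i ∨ v j) ≤ count u * n + m * count v
weight-cross {m} {n} u v = begin
  weight (λ i j → u i ∨ v j)
    ≡⟨ weight≡sum-count (λ i j → u i ∨ v j) ⟩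
  sum (λ i → count (λ j → u i ∨ v j))
    ≤⟨ sum-mono-≤ (λ i → count-∨ (λ _ → u i) v) ⟩
  sum (λ i → count {n} (λ _ → u i) + count v)
    ≡⟨ ∑-distrib-+ (λ i → count {n} (λ _ → u i)) (λ _ → count v) ⟩
  sum (λ i → count {n} (λ _ → u i)) + sum {m} (λ _ → count v)
    ≡⟨ cong₂ _+_ (sum-cong-≗ (λ i → count-const n (u i))) (sum-const m (count v)) ⟩
  sum (λ i → b2n (u i) * n) + m * count v
    ≡⟨ cong (_+ m * count v) (*-distribʳ-sum n (b2n ∘ u)) ⟨
  count u * n + m * count v
    ∎

-- Sparse semisaturating matrices

EmptyRow : ∀ {m n} → Mat m n → Fin m → Set
EmptyRow M i = ∀ j → M i j ≡ false

EmptyColumn : ∀ {m n} → Mat m n → Fin n → Set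
EmptyColumn M j = ∀ i → M i j ≡ false

count≡0⇒all-false : ∀ {n} (u : Fin n → Bool) → count u ≡ 0 → ∀ x → u x ≡ false
count≡0⇒all-false u c≡0 x = b2n≡0 (u x) (sum≡0⇒≡0 (b2n ∘ u) c≡0 x)
  where
  b2n≡0 : ∀ y → b2n y ≡ 0 → y ≡ false
  b2n≡0 false _ = refl

weight<⇒emptyRow : ∀ {m n} (M : Mat m n) → weight M < m → ∃[ i ] EmptyRow M i
weight<⇒emptyRow M w<m with sum<length⇒∃≡0 (λ i → count (M i)) (subst (_< _) (weight≡sum-count M) w<m)
... | i , count≡0 = i , count≡0⇒all-false (M i) count≡0

weight<⇒emptyColumn : ∀ {m n} (M : Mat m n) → weight M < n → ∃[ j ] EmptyColumn M j
weight<⇒emptyColumn M w<n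
  with sum<length⇒∃≡0 (λ j → count (λ i → M i j)) (subst (_< _) (weight≡sum-countᵀ M) w<n)
... | j , count≡0 = j , count≡0⇒all-false (λ i → M i j) count≡0

setOne-self : ∀ {m n} (M : Mat m n) i j → setOne M i j i j ≡ true
setOne-self M i j with i ≟ i | j ≟ j
... | yes _   | yes _   = refl
... | no i≢i  | _       = contradiction refl i≢i
... | yes _   | no j≢j  = contradiction refl j≢j

setOne-mono : ∀ {m n} (M : Mat m n) i j x y → M x y ≡ true → setOne M i j x y ≡ true
setOne-mono M i j x y Mxy with does (x ≟ i) ∧ does (y ≟ j)
... | true  = refl
... | false = Mxy

setOne-true : ∀ {m n} (M : Mat m n) i j x y → setOne M i j x y ≡ true →
              (x ≡ i × y ≡ j) ⊎ M x y ≡ true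
setOne-true M i j x y M′xy with x ≟ i | y ≟ j
... | yes x≡i | yes y≡j = inj₁ (x≡i , y≡j)
... | yes _   | no _    = inj₂ M′xy
... | no _    | _       = inj₂ M′xy

strictlyIncreasing-injective : ∀ {k m} {r : Fin k → Fin m} → StrictlyIncreasing r →
                               ∀ {a a′} → r a ≡ r a′ → a ≡ a′
strictlyIncreasing-injective sr {a} {a′} ra≡ra′ with F.<-cmp a a′
... | tri< a<a′ _ _ = contradiction ra≡ra′ (F.<⇒≢ (sr a a′ a<a′))
... | tri≈ _ a≡a′ _ = a≡a′
... | tri> _ _ a′<a = contradiction (sym ra≡ra′) (F.<⇒≢ (sr a′ a a′<a))

strictlyIncreasing-first : ∀ {k m} {r : Fin k → Fin m} → StrictlyIncreasing r →
                           ∀ a → toℕ (r a) ≡ 0 → toℕ a ≡ 0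
strictlyIncreasing-first sr fzero    _      = refl
strictlyIncreasing-first sr (fsuc a) ra≡0 =
  contradiction ra≡0 (>⇒≢ (≤-<-trans z≤n (sr fzero (fsuc a) z<s)))

strictlyIncreasing-last : ∀ {k m} {r : Fin k → Fin m} → StrictlyIncreasing r →
                          ∀ a → suc (toℕ (r a)) ≡ m → suc (toℕ a) ≡ k
strictlyIncreasing-last {suc k} {r = r} sr a ra-last with m≤n⇒m<n∨m≡n (F.toℕ≤pred[n] a)
... | inj₂ a≡k = cong suc a≡k
... | inj₁ a<k =
  contradiction ra-last (<⇒≢ (≤-trans (s≤s (sr a (fromℕ k) a<last)) (F.toℕ<n (r (fromℕ k)))))
  where
  a<last : toℕ a < toℕ (fromℕ k)
  a<last = subst (toℕ a <_) (sym (F.toℕ-fromℕ k)) a<k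

newOccurrence-hits : ∀ {k l m n} {P : Mat k l} {M : Mat m n} {i j r c} →
                     IsOccurrence P (setOne M i j) r c → ¬ IsOccurrence P M r c →
                     ∃[ a ] ∃[ b ] (P a b ≡ true × r a ≡ i × c b ≡ j)
newOccurrence-hits {P = P} {M} {i} {j} {r} {c} (sr , sc , occ) not-old
  with F.any? (λ a → F.any? (λ b → (P a b B.≟ true) ×-dec (r a ≟ i) ×-dec (c b ≟ j)))
... | yes hit   = hit
... | no no-hit = contradiction (sr , sc , old) not-old
  where
  old : ∀ a b → P a b ≡ true → M (r a) (c b) ≡ true
  old a b pab with setOne-true M i j (r a) (c b) (occ a b pab)
  ... | inj₁ (ra≡i , cb≡j) = contradiction (a , b , pab , ra≡i , cb≡j) no-hit
  ... | inj₂ Mrc           = Mrc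

hit-in-emptyColumn⇒onlyInColumn :
  ∀ {k l m n} {P : Mat k l} {M : Mat m n} {i j r c a b} →
  IsOccurrence P (setOne M i j) r c → EmptyColumn M j →
  P a b ≡ true → r a ≡ i → c b ≡ j → OnlyInColumn P a b
hit-in-emptyColumn⇒onlyInColumn {P = P} {M} {i} {j} {r} {c} {a} {b} (sr , _ , occ) empty pab ra≡i cb≡j =
  pab , unique
  where
  unique : ∀ a′ → P a′ b ≡ true → a′ ≡ a
  unique a′ pa′b with setOne-true M i j (r a′) (c b) (occ a′ b pa′b)
  ... | inj₁ (ra′≡i , _) = strictlyIncreasing-injective sr (trans ra′≡i (sym ra≡i))
  ... | inj₂ Mrc         =
    contradiction (trans (sym Mrc) (trans (cong (M (r a′)) cb≡j) (empty (r a′)))) λ ()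

hit-in-emptyRow⇒onlyInRow :
  ∀ {k l m n} {P : Mat k l} {M : Mat m n} {i j r c a b} →
  IsOccurrence P (setOne M i j) r c → EmptyRow M i →
  P a b ≡ true → r a ≡ i → c b ≡ j → OnlyInRow P a b
hit-in-emptyRow⇒onlyInRow {P = P} {M} {i} {j} {r} {c} {a} {b} (_ , sc , occ) empty pab ra≡i cb≡j =
  pab , unique
  where
  unique : ∀ b′ → P a b′ ≡ true → b′ ≡ b
  unique b′ pab′ with setOne-true M i j (r a) (c b′) (occ a b′ pab′)
  ... | inj₁ (_ , cb′≡j) = strictlyIncreasing-injective sc (trans cb′≡j (sym cb≡j))
  ... | inj₂ Mrc         =
    contradiction (trans (sym Mrc) (trans (cong (λ x → M x (c b′)) ra≡i) (empty (c b′)))) λ ()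

emptyColumn-witness : ∀ {k l m n} {P : Mat k l} {M : Mat m n} → IsSemisaturating P M →
                      ∀ j → EmptyColumn M j → (i : Fin m) →
                      ∃[ a ] ∃[ b ] Σ (Fin k → Fin m) λ r →
                        StrictlyIncreasing r × r a ≡ i × OnlyInColumn P a b
emptyColumn-witness {M = M} S j empty i with S i j (empty i)
... | r , c , occ , not-old with newOccurrence-hits {M = M} occ not-old
...   | a , b , pab , ra≡i , cb≡j =
        a , b , r , proj₁ occ , ra≡i , hit-in-emptyColumn⇒onlyInColumn occ empty pab ra≡i cb≡j

emptyRow-witness : ∀ {k l m n} {P : Mat k l} {M : Mat m n} → IsSemisaturating P M →
                   ∀ i → EmptyRow M i → (j : Fin n) →
                   ∃[ a ] ∃[ b ] Σ (Fin l → Fin n) λ c →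
                     StrictlyIncreasing c × c b ≡ j × OnlyInRow P a b
emptyRow-witness {M = M} S i empty j with S i j (empty j)
... | r , c , occ , not-old with newOccurrence-hits {M = M} occ not-old
...   | a , b , pab , ra≡i , cb≡j =
        a , b , c , proj₁ (proj₂ occ) , cb≡j , hit-in-emptyRow⇒onlyInRow occ empty pab ra≡i cb≡j

emptyColumn⇒Cond1 : ∀ {k l m n} {P : Mat k l} {M : Mat (suc m) n} →
                    IsSemisaturating P M → ∀ j → EmptyColumn M j → Cond1 P
emptyColumn⇒Cond1 {m = m} S j empty
  with emptyColumn-witness S j empty fzero | emptyColumn-witness S j empty (fromℕ m)
... | a , b , r , sr , ra≡first , only | a′ , b′ , r′ , sr′ , r′a′≡last , only′ =
  (a , b , strictlyIncreasing-first sr a (cong toℕ ra≡first) , only) ,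
  (a′ , b′ ,
   strictlyIncreasing-last sr′ a′ (cong suc (trans (cong toℕ r′a′≡last) (F.toℕ-fromℕ m))) , only′)

emptyRow⇒Cond2 : ∀ {k l m n} {P : Mat k l} {M : Mat m (suc n)} →
                 IsSemisaturating P M → ∀ i → EmptyRow M i → Cond2 P
emptyRow⇒Cond2 {n = n} S i empty
  with emptyRow-witness S i empty fzero | emptyRow-witness S i empty (fromℕ n)
... | a , b , c , sc , cb≡first , only | a′ , b′ , c′ , sc′ , c′b′≡last , only′ =
  (a , b , strictlyIncreasing-first sc b (cong toℕ cb≡first) , only) ,
  (a′ , b′ ,
   strictlyIncreasing-last sc′ b′ (cong suc (trans (cong toℕ c′b′≡last) (F.toℕ-fromℕ n))) , only′)

emptyRowAndColumn⇒Cond3 : ∀ {k l m n} {P : Mat k l} {M : Mat m n} → IsSemisaturating P M →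
                          ∀ {i j} → EmptyRow M i → EmptyColumn M j → Cond3 P
emptyRowAndColumn⇒Cond3 {M = M} S {i} {j} emptyRow emptyColumn with S i j (emptyRow j)
... | r , c , occ , not-old with newOccurrence-hits {M = M} occ not-old
...   | a , b , pab , ra≡i , cb≡j =
        a , b , hit-in-emptyRow⇒onlyInRow occ emptyRow pab ra≡i cb≡j ,
                hit-in-emptyColumn⇒onlyInColumn occ emptyColumn pab ra≡i cb≡j

sparse⇒conditions : ∀ {k l n} {P : Mat k l} {M : Mat n n} → IsSemisaturating P M →
                    weight M < n → Cond1 P × Cond2 P × Cond3 P
sparse⇒conditions {n = suc n} {M = M} S w<n
  with weight<⇒emptyRow M w<n | weight<⇒emptyColumn M w<n
... | i , emptyRow | j , emptyColumn =
  emptyColumn⇒Cond1 S j emptyColumn ,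
  emptyRow⇒Cond2 S i emptyRow ,
  emptyRowAndColumn⇒Cond3 S emptyRow emptyColumn

-- Sending a pattern into the band through one prescribed entry

InBand : (w n v : ℕ) → Set
InBand w n v = v < w ⊎ n ≤ v + w

inBand? : ∀ w n v → Dec (InBand w n v)
inBand? w n v = v <? w ⊎-dec n ≤? v + w

band : (w n : ℕ) → Fin n → Bool
band w n v = does (inBand? w n (toℕ v))

band-true : ∀ {w n} {x : Fin n} → InBand w n (toℕ x) → band w n x ≡ true
band-true {w} {n} {x} = dec-true (inBand? w n (toℕ x))

InBand-mono : ∀ {w w′ n v} → w ≤ w′ → InBand w n v → InBand w′ n v
InBand-mono w≤w′ (inj₁ v<w)   = inj₁ (<-≤-trans v<w w≤w′)
InBand-mono w≤w′ (inj₂ n≤v+w) = inj₂ (≤-trans n≤v+w (+-monoʳ-≤ _ w≤w′))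

count-band : ∀ w n → count (band w n) ≤ w + w
count-band w n = ≤-trans (count-∨ {n} (λ v → does (toℕ v <? w)) (λ v → does (n ≤? toℕ v + w)))
                         (+-mono-≤ (count-below n w) (count-above n w))

spread : (d a i v : ℕ) → ℕ
spread d a i v with <-cmp v a
... | tri< _ _ _ = v
... | tri≈ _ _ _ = i
... | tri> _ _ _ = d + v

module _ {d a i : ℕ} where

  spread-at : spread d a i a ≡ i
  spread-at with <-cmp a a
  ... | tri< a<a _ _ = contradiction a<a (<-irrefl refl)
  ... | tri≈ _ _ _   = refl
  ... | tri> _ _ a<a = contradiction a<a (<-irrefl refl)

  spread-above : ∀ {v} → a < v → spread d a i v ≡ d + v
  spread-above {v} a<v with <-cmp v a
  ... | tri< _ _ v≯a = contradiction a<v v≯a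
  ... | tri≈ _ _ v≯a = contradiction a<v v≯a
  ... | tri> _ _ _   = refl

  spread-≥ : a ≤ i → ∀ v → v ≤ spread d a i v
  spread-≥ a≤i v with <-cmp v a
  ... | tri< _ _ _   = ≤-refl
  ... | tri≈ _ v≡a _ = ≤-trans (≤-reflexive v≡a) a≤i
  ... | tri> _ _ _   = m≤n+m v d

  spread-≤ : i ≤ d + a → ∀ v → spread d a i v ≤ d + v
  spread-≤ i≤d+a v with <-cmp v a
  ... | tri< _ _ _   = m≤n+m v d
  ... | tri≈ _ v≡a _ = ≤-trans i≤d+a (+-monoʳ-≤ d (≤-reflexive (sym v≡a)))
  ... | tri> _ _ _   = ≤-refl

  spread-mono : a ≤ i → i ≤ d + a → ∀ {v v′} → v < v′ → spread d a i v < spread d a i v′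
  spread-mono a≤i i≤d+a {v} {v′} v<v′ with <-cmp v a
  ... | tri< _ _ _   = <-≤-trans v<v′ (spread-≥ a≤i v′)
  ... | tri≈ _ v≡a _ = subst (i <_) (sym (spread-above a<v′)) (≤-<-trans i≤d+a (+-monoʳ-< d a<v′))
    where a<v′ = subst (_< v′) v≡a v<v′
  ... | tri> _ _ a<v = subst (d + v <_) (sym (spread-above (<-trans a<v v<v′))) (+-monoʳ-< d v<v′)

  spread-outer : ∀ {k v} → v < k → v ≢ a → InBand k (d + k) (spread d a i v)
  spread-outer {k} {v} v<k v≢a with <-cmp v a
  ... | tri< _ _ _   = inj₁ v<k
  ... | tri≈ _ v≡a _ = contradiction v≡a v≢a
  ... | tri> _ _ _   = inj₂ (+-monoˡ-≤ k (m≤m+n d v))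

Placeable : ∀ {k n} → Fin k → Fin n → Set
Placeable {k} {n} a i = toℕ a ≤ toℕ i × toℕ i + k ≤ n + toℕ a

placement : ∀ {k n} {a : Fin k} {i : Fin n} → Placeable a i →
            Σ (Fin k → Fin n) λ r →
              StrictlyIncreasing r × r a ≡ i × (∀ x → x ≢ a → InBand k n (toℕ (r x)))
placement {k} {n} {a} {i} (a≤i , room) = r , r-mono , r-at , r-outer
  where
  k≤n : k ≤ n
  k≤n = +-cancelˡ-≤ (toℕ a) k n
          (≤-trans (+-monoˡ-≤ k a≤i) (≤-trans room (≤-reflexive (+-comm n (toℕ a)))))

  d = n ∸ k

  d+k≡n : d + k ≡ n
  d+k≡n = m∸n+n≡m k≤n

  i≤d+a : toℕ i ≤ d + toℕ a
  i≤d+a = subst (toℕ i ≤_) (+-∸-comm (toℕ a) k≤n) (m+n≤o⇒m≤o∸n (toℕ i) room)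

  f : ℕ → ℕ
  f = spread d (toℕ a) (toℕ i)

  f<n : ∀ (x : Fin k) → f (toℕ x) < n
  f<n x = ≤-<-trans (spread-≤ i≤d+a (toℕ x)) (subst (d + toℕ x <_) d+k≡n (+-monoʳ-< d (F.toℕ<n x)))

  r : Fin k → Fin n
  r x = fromℕ< (f<n x)

  toℕ-r : ∀ x → toℕ (r x) ≡ f (toℕ x)
  toℕ-r x = F.toℕ-fromℕ< (f<n x)

  r-mono : StrictlyIncreasing r
  r-mono x y x<y = subst₂ _<_ (sym (toℕ-r x)) (sym (toℕ-r y)) (spread-mono a≤i i≤d+a x<y)

  r-at : r a ≡ i
  r-at = F.toℕ-injective (trans (toℕ-r a) (spread-at {d} {toℕ a} {toℕ i}))

  r-outer : ∀ x → x ≢ a → InBand k n (toℕ (r x))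
  r-outer x x≢a =
    subst₂ (InBand k) d+k≡n (sym (toℕ-r x)) (spread-outer (F.toℕ<n x) (x≢a ∘ F.toℕ-injective))

module _ {k n w : ℕ} (k≤w : k ≤ w) where

  placeable-inner : ∀ {a : Fin k} {i : Fin n} → ¬ InBand w n (toℕ i) → Placeable a i
  placeable-inner {a} {i} i∉band =
    a≤i , ≤-trans (+-monoʳ-≤ (toℕ i) k≤w) (≤-trans (<⇒≤ i+w<n) (m≤m+n n (toℕ a)))
    where
    a≤i : toℕ a ≤ toℕ i
    a≤i = ≤-trans (<⇒≤ (<-≤-trans (F.toℕ<n a) k≤w)) (≮⇒≥ (i∉band ∘ inj₁))
    i+w<n : toℕ i + w < n
    i+w<n = ≰⇒> (i∉band ∘ inj₂)

  placeable-first : w + w ≤ n → ∀ {a : Fin k} {i : Fin n} → toℕ a ≡ 0 → toℕ i < w → Placeable a i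
  placeable-first w+w≤n {a} {i} a≡0 i<w =
    ≤-trans (≤-reflexive a≡0) z≤n ,
    ≤-trans (+-mono-≤ (<⇒≤ i<w) k≤w) (≤-trans w+w≤n (m≤m+n n (toℕ a)))

  placeable-last : w + w ≤ n → ∀ {a : Fin k} {i : Fin n} →
                   suc (toℕ a) ≡ k → n ≤ toℕ i + w → Placeable a i
  placeable-last w+w≤n {a} {i} a-last n≤i+w = a≤i , room
    where
    a≤i : toℕ a ≤ toℕ i
    a≤i = ≤-trans (<⇒≤ (<-≤-trans (F.toℕ<n a) k≤w)) (+-cancelʳ-≤ w w (toℕ i) (≤-trans w+w≤n n≤i+w))
    room : toℕ i + k ≤ n + toℕ a
    room = begin
      toℕ i + k            ≡⟨ cong (toℕ i +_) a-last ⟨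
      toℕ i + suc (toℕ a)  ≡⟨ +-suc (toℕ i) (toℕ a) ⟩
      suc (toℕ i) + toℕ a  ≤⟨ +-monoˡ-≤ (toℕ a) (F.toℕ<n i) ⟩
      n + toℕ a            ∎

NewOccurrenceAt : ∀ {k l m n} → Mat k l → Mat m n → Fin m → Fin n → Set
NewOccurrenceAt {k} {l} {m} {n} P M i j =
  Σ (Fin k → Fin m) λ r → Σ (Fin l → Fin n) λ c →
    IsOccurrence P (setOne M i j) r c × ¬ IsOccurrence P M r c

newOccurrence : ∀ {k l m n} {P : Mat k l} {M : Mat m n} {r c a b} →
                M (r a) (c b) ≡ false → StrictlyIncreasing r → StrictlyIncreasing c → P a b ≡ true →
                (∀ x y → P x y ≡ true → (x ≡ a × y ≡ b) ⊎ M (r x) (c y) ≡ true) →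
                NewOccurrenceAt P M (r a) (c b)
newOccurrence {P = P} {M} {r} {c} {a} {b} M≡false sr sc pab covered = r , c , (sr , sc , new) , not-old
  where
  new : ∀ x y → P x y ≡ true → setOne M (r a) (c b) (r x) (c y) ≡ true
  new x y pxy with covered x y pxy
  ... | inj₁ (refl , refl) = setOne-self M (r a) (c b)
  ... | inj₂ M≡true       = setOne-mono M (r a) (c b) (r x) (c y) M≡true

  not-old : ¬ IsOccurrence P M r c
  not-old (_ , _ , old) = contradiction (trans (sym (old a b pab)) M≡false) λ ()

module _ {k l n w : ℕ} (P : Mat k l) (k≤w : k ≤ w) (l≤w : l ≤ w) where

  bandOccurrence :
    (M : Mat n n) → (∀ {x y} → InBand w n (toℕ x) → InBand w n (toℕ y) → M x y ≡ true) →
    ∀ {i j a b} → M i j ≡ false → P a b ≡ true → Placeable a i → Placeable b j →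
    (∀ y → P a y ≡ true → y ≢ b → ∀ y′ → InBand w n (toℕ y′) → M i y′ ≡ true) →
    (∀ x → P x b ≡ true → x ≢ a → ∀ x′ → InBand w n (toℕ x′) → M x′ j ≡ true) →
    NewOccurrenceAt P M i j
  bandOccurrence M grid {a = a} {b} Mij≡false pab a↦i b↦j row column
    with placement a↦i | placement b↦j
  ... | r , sr , refl , r-outer | c , sc , refl , c-outer = newOccurrence {M = M} Mij≡false sr sc pab covered
    where
    covered : ∀ x y → P x y ≡ true → (x ≡ a × y ≡ b) ⊎ M (r x) (c y) ≡ true
    covered x y pxy with x ≟ a | y ≟ b
    ... | yes x≡a  | yes y≡b = inj₁ (x≡a , y≡b)
    ... | yes refl | no y≢b  = inj₂ (row y pxy y≢b (c y) (InBand-mono l≤w (c-outer y y≢b)))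
    ... | no x≢a   | yes refl = inj₂ (column x pxy x≢a (r x) (InBand-mono k≤w (r-outer x x≢a)))
    ... | no x≢a   | no y≢b  =
      inj₂ (grid (InBand-mono k≤w (r-outer x x≢a)) (InBand-mono l≤w (c-outer y y≢b)))

-- The corner and frame matrices

cornerMatrix : (w n : ℕ) → Mat n n
cornerMatrix w n x y = band w n x ∧ band w n y

frameMatrix : (w n : ℕ) → Mat n n
frameMatrix w n x y = band w n x ∨ band w n y

weight-cornerMatrix : ∀ w n → weight (cornerMatrix w n) ≤ (w + w) * (w + w)
weight-cornerMatrix w n = begin
  weight (cornerMatrix w n)                ≡⟨ weight-grid (band w n) (band w n) ⟩
  count (band w n) * count (band w n)      ≤⟨ *-mono-≤ (count-band w n) (count-band w n) ⟩
  (w + w) * (w + w)                        ∎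

weight-frameMatrix : ∀ w n → weight (frameMatrix w n) ≤ ((w + w) + (w + w)) * n
weight-frameMatrix w n = begin
  weight (frameMatrix w n)                      ≤⟨ weight-cross (band w n) (band w n) ⟩
  count (band w n) * n + n * count (band w n)
    ≤⟨ +-mono-≤ (*-monoˡ-≤ n (count-band w n)) (*-monoʳ-≤ n (count-band w n)) ⟩
  (w + w) * n + n * (w + w)                     ≡⟨ cong ((w + w) * n +_) (*-comm n (w + w)) ⟩
  (w + w) * n + (w + w) * n                     ≡⟨ *-distribʳ-+ n (w + w) (w + w) ⟨
  ((w + w) + (w + w)) * n                       ∎

module _ {w n : ℕ} {x y : Fin n} where

  corner-true : InBand w n (toℕ x) → InBand w n (toℕ y) → cornerMatrix w n x y ≡ true
  corner-true x∈ y∈ = cong₂ _∧_ (band-true x∈) (band-true y∈)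

  frame-trueˡ : InBand w n (toℕ x) → frameMatrix w n x y ≡ true
  frame-trueˡ x∈ = cong (_∨ band w n y) (band-true x∈)

  frame-trueʳ : InBand w n (toℕ y) → frameMatrix w n x y ≡ true
  frame-trueʳ y∈ = trans (cong (band w n x ∨_) (band-true y∈)) (B.∨-zeroʳ (band w n x))

module _ {k l : ℕ} (P : Mat k l) {n : ℕ} (wide : (k + l) + (k + l) ≤ n) where

  private
    w = k + l

    k≤w : k ≤ w
    k≤w = m≤m+n k l

    l≤w : l ≤ w
    l≤w = m≤n+m l k

    corner-rowCovered : ∀ {i a b} → InBand w n (toℕ i) ⊎ OnlyInRow P a b →
                        ∀ y → P a y ≡ true → y ≢ b →
                        ∀ y′ → InBand w n (toℕ y′) → cornerMatrix w n i y′ ≡ true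
    corner-rowCovered (inj₁ i∈)           _ _   _   _ y′∈ = corner-true i∈ y′∈
    corner-rowCovered (inj₂ (_ , unique)) y pay y≢b _ _   = contradiction (unique y pay) y≢b

    corner-columnCovered : ∀ {j a b} → InBand w n (toℕ j) ⊎ OnlyInColumn P a b →
                           ∀ x → P x b ≡ true → x ≢ a →
                           ∀ x′ → InBand w n (toℕ x′) → cornerMatrix w n x′ j ≡ true
    corner-columnCovered (inj₁ j∈)           _ _   _   _ x′∈ = corner-true x′∈ j∈
    corner-columnCovered (inj₂ (_ , unique)) x pxb x≢a _ _   = contradiction (unique x pxb) x≢a

    cornerOccurrence : ∀ {i j a b} → cornerMatrix w n i j ≡ false → P a b ≡ true →
                       Placeable a i → Placeable b j →
                       InBand w n (toℕ i) ⊎ OnlyInRow P a b → InBand w n (toℕ j) ⊎ OnlyInColumn P a b →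
                       NewOccurrenceAt P (cornerMatrix w n) i j
    cornerOccurrence Mij≡false pab a↦i b↦j row column =
      bandOccurrence P k≤w l≤w (cornerMatrix w n) corner-true Mij≡false pab a↦i b↦j
        (corner-rowCovered row) (corner-columnCovered column)

  corner-semisaturating : Cond1 P × Cond2 P × Cond3 P → IsSemisaturating P (cornerMatrix w n)
  corner-semisaturating conditions i j Mij≡false with inBand? w n (toℕ i) | inBand? w n (toℕ j)
  ... | yes i∈ | yes j∈ = contradiction (trans (sym Mij≡false) (corner-true i∈ j∈)) λ ()
  corner-semisaturating ((first , _) , _) i j Mij≡false | yes i∈@(inj₁ i<w) | no j∉ with first
  ... | a , b , a≡0 , onlyColumn@(pab , _) =
    cornerOccurrence Mij≡false pab (placeable-first k≤w wide a≡0 i<w) (placeable-inner l≤w j∉)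
      (inj₁ i∈) (inj₂ onlyColumn)
  corner-semisaturating ((_ , last) , _) i j Mij≡false | yes i∈@(inj₂ n≤i+w) | no j∉ with last
  ... | a , b , a-last , onlyColumn@(pab , _) =
    cornerOccurrence Mij≡false pab (placeable-last k≤w wide a-last n≤i+w) (placeable-inner l≤w j∉)
      (inj₁ i∈) (inj₂ onlyColumn)
  corner-semisaturating (_ , (first , _) , _) i j Mij≡false | no i∉ | yes j∈@(inj₁ j<w) with first
  ... | a , b , b≡0 , onlyRow@(pab , _) =
    cornerOccurrence Mij≡false pab (placeable-inner k≤w i∉) (placeable-first l≤w wide b≡0 j<w)
      (inj₂ onlyRow) (inj₁ j∈)
  corner-semisaturating (_ , (_ , last) , _) i j Mij≡false | no i∉ | yes j∈@(inj₂ n≤j+w) with last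
  ... | a , b , b-last , onlyRow@(pab , _) =
    cornerOccurrence Mij≡false pab (placeable-inner k≤w i∉) (placeable-last l≤w wide b-last n≤j+w)
      (inj₂ onlyRow) (inj₁ j∈)
  corner-semisaturating (_ , _ , (a , b , onlyRow@(pab , _) , onlyColumn)) i j Mij≡false | no i∉ | no j∉ =
    cornerOccurrence Mij≡false pab (placeable-inner k≤w i∉) (placeable-inner l≤w j∉)
      (inj₂ onlyRow) (inj₂ onlyColumn)

  frame-semisaturating : IsPattern P → IsSemisaturating P (frameMatrix w n)
  frame-semisaturating (a , b , pab) i j Mij≡false with inBand? w n (toℕ i) | inBand? w n (toℕ j)
  ... | yes i∈ | _      = contradiction (trans (sym Mij≡false) (frame-trueˡ i∈)) λ ()
  ... | no _   | yes j∈ = contradiction (trans (sym Mij≡false) (frame-trueʳ j∈)) λ ()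
  ... | no i∉  | no j∉  =
    bandOccurrence P k≤w l≤w (frameMatrix w n) (λ x∈ _ → frame-trueˡ x∈) Mij≡false pab
      (placeable-inner k≤w i∉) (placeable-inner l≤w j∉)
      (λ _ _ _ _ y′∈ → frame-trueʳ y′∈) (λ _ _ _ _ x′∈ → frame-trueˡ x′∈)

theorem8 : ∀ {k l : ℕ} (P : Mat k l) → IsPattern P →
    (SsatBounded P ⇔ (Cond1 P × Cond2 P × Cond3 P)) ×
    (¬ (Cond1 P × Cond2 P × Cond3 P) → SsatLinear P)
theorem8 {k} {l} P isPattern = mk⇔ bounded⇒conditions conditions⇒bounded , ¬conditions⇒linear
  where
  w = k + l

  bounded⇒conditions : SsatBounded P → Cond1 P × Cond2 P × Cond3 P
  bounded⇒conditions (C , N , ssat≤C) with ssat≤C (N + suc C) (m≤m+n N (suc C))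
  ... | M , S , weight≤C =
    sparse⇒conditions S (≤-<-trans weight≤C (<-≤-trans (n<1+n C) (m≤n+m (suc C) N)))

  conditions⇒bounded : Cond1 P × Cond2 P × Cond3 P → SsatBounded P
  conditions⇒bounded conditions =
    (w + w) * (w + w) , w + w ,
    λ n wide → cornerMatrix w n , corner-semisaturating P wide conditions , weight-cornerMatrix w n

  ¬conditions⇒linear : ¬ (Cond1 P × Cond2 P × Cond3 P) → SsatLinear P
  ¬conditions⇒linear ¬conditions =
    1 , (w + w) + (w + w) , w + w ,
    λ n wide → sparse-excluded n ,
               (frameMatrix w n , frame-semisaturating P wide isPattern , weight-frameMatrix w n)
    where
    sparse-excluded : ∀ n (M : Mat n n) → IsSemisaturating P M → n ≤ 1 * weight M
    sparse-excluded n M S =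
      subst (n ≤_) (sym (*-identityˡ (weight M))) (≮⇒≥ (¬conditions ∘ sparse⇒conditions S))
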